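{- Let $m\ge 3$ and let $\alpha,\beta\in\mathbb{Z}_m$ with $\alpha\ne 0$, $\beta\ne 0$, $\alpha\ne\beta$ and $2(\alpha-\beta)\not\equiv 0\pmod m$. Let $G_6$ be the voltage graph over $\mathbb{Z}_m$ with vertices $x^{*},x,x_0,y_0,y,y^{*}$, where $x^{*}$ and $y^{*}$ are pinned, with edges $x^{*}x$, $xx_0$, $xy$, $yy_0$, $yy^{*}$ all of voltage $0$, and with two arcs from $x_0$ to $y_0$ labelled $\alpha$ and $\beta$. Then the derived graph $(G_6,m)$ has girth $6$; it is a $(3,m;6)$-graph in which the two vertices $x^{*},y^{*}$ have degree $m$ and the remaining $4m$ vertices have degree $3$.
   Context: A voltage graph over $\mathbb{Z}_m$ is a finite directed multigraph with arc labels in $\mathbb{Z}_m$; some degree-$1$ vertices are pinned. Derived graph $(G,m)$: each non-pinned vertex $v$ gives $m$ vertices $v^0,\dots,v^{m-1}$; each pinned vertex $v^{*}$ gives a single vertex; an arc $v\to w$ labelled $a$ between non-pinned vertices gives edges $v^iw^{i+a}$ for all $i$ (indices mod $m$); an edge $v^{*}w$ with $v^{*}$ pinned gives edges $v^{*}w^i$ for all $i$. A $(3,m;g)$-graph is a graph of girth $g$ all of whose vertices have degree $3$ or $m$. -}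

module Defs where

open import Data.Nat using (ℕ; zero; suc; _+_; _*_; _<_; NonZero)
open import Data.Nat.DivMod using (_mod_)
open import Data.Fin using (Fin; toℕ) renaming (zero to fz; suc to fs)
import Data.Fin.Properties as FinP
open import Data.Product using (Σ; ∃; _×_; _,_; proj₁; proj₂)
open import Data.Sum using (_⊎_; inj₁; inj₂)
import Data.Sum.Properties as SumP
import Data.Product.Properties as ProdP
open import Data.List using (List; map; _++_; cartesianProduct; allFin)
open import Data.Nat.ListAction using (sum)
open import Data.Empty using (⊥)
open import Relation.Nullary using (¬_; yes; no)
open import Relation.Binary.PropositionalEquality using (_≡_)
open import Relation.Binary.Definitions using (DecidableEquality)
open import Function.Definitions using (Injective)

module _ (m : ℕ) .{{_ : NonZero m}} where
  addMod : Fin m → Fin m → Fin m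
  addMod a b = (toℕ a + toℕ b) mod m

  zeroMod : Fin m
  zeroMod = 0 mod m

-- Voltage graphs over ℤ_m.
-- nV non-pinned vertices (Fin nV), nP pinned vertices (Fin nP),
-- nA arcs between non-pinned vertices (tail, head, voltage),
-- nE edges between a pinned vertex and a non-pinned vertex.

record VoltageGraph (m : ℕ) : Set where
  field
    nV nP nA nE : ℕ
    arc    : Fin nA → Fin nV × Fin nV × Fin m
    pinned : Fin nE → Fin nP × Fin nV

record Multigraph : Set₁ where
  field
    V E   : Set
    ends  : E → V × V
    _≟V_  : DecidableEquality V
    edges : List E          -- enumeration of all edges (each exactly once)

module _ (G : Multigraph) where
  open Multigraph G

  Joins : E → V → V → Set
  Joins e u v = (ends e ≡ (u , v)) ⊎ (ends e ≡ (v , u))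

  next : ∀ {j} → Fin (suc j) → Fin (suc j)
  next {j} i = suc (toℕ i) mod suc j

  CycleOfLength : ℕ → Set
  CycleOfLength zero    = ⊥
  CycleOfLength (suc j) =
    Σ (Fin (suc j) → V) λ vs → Σ (Fin (suc j) → E) λ es →
      Injective _≡_ _≡_ vs × Injective _≡_ _≡_ es ×
      (∀ i → Joins (es i) (vs i) (vs (next i)))

  HasGirth : ℕ → Set
  HasGirth g = CycleOfLength g × (∀ k → k < g → ¬ CycleOfLength k)

  -- degree = number of edge-ends at v (a loop counts twice)
  deg : V → ℕ
  deg v = sum (map inc edges)
    where
      ind : V → ℕ
      ind u with u ≟V v
      ... | yes _ = 1
      ... | no  _ = 0
      inc : E → ℕ
      inc e = ind (proj₁ (ends e)) + ind (proj₂ (ends e))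

  Is3mgGraph : ℕ → ℕ → Set
  Is3mgGraph m g = HasGirth g × (∀ v → deg v ≡ 3 ⊎ deg v ≡ m)

module _ {m : ℕ} .{{_ : NonZero m}} (Γ : VoltageGraph m) where
  open VoltageGraph Γ

  DVertex : Set
  DVertex = Fin nP ⊎ (Fin nV × Fin m)

  DEdge : Set
  DEdge = (Fin nA × Fin m) ⊎ (Fin nE × Fin m)

  dEnds : DEdge → DVertex × DVertex
  dEnds (inj₁ (k , i)) with arc k
  ... | (v , w , a) = inj₂ (v , i) , inj₂ (w , addMod m i a)
  dEnds (inj₂ (k , i)) with pinned k
  ... | (p , w) = inj₁ p , inj₂ (w , i)

  derived : Multigraph
  derived = record
    { V = DVertex
    ; E = DEdge
    ; ends = dEnds
    ; _≟V_ = SumP.≡-dec FinP._≟_ (ProdP.≡-dec FinP._≟_ FinP._≟_)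
    ; edges = map inj₁ (cartesianProduct (allFin nA) (allFin m))
           ++ map inj₂ (cartesianProduct (allFin nE) (allFin m))
    }

vx vx₀ vy₀ vy : Fin 4
vx  = fz
vx₀ = fs fz
vy₀ = fs (fs fz)
vy  = fs (fs (fs fz))

x* y* : Fin 2
x* = fz
y* = fs fz

G₆ : (m : ℕ) .{{_ : NonZero m}} → Fin m → Fin m → VoltageGraph m
G₆ m α β = record
  { nV = 4 ; nP = 2 ; nA = 5 ; nE = 2
  ; arc = arcs
  ; pinned = pins
  }
  where
    arcs : Fin 5 → Fin 4 × Fin 4 × Fin m
    arcs fz                          = vx  , vx₀ , zeroMod m
    arcs (fs fz)                     = vx  , vy  , zeroMod m
    arcs (fs (fs fz))                = vy  , vy₀ , zeroMod m
    arcs (fs (fs (fs fz)))           = vx₀ , vy₀ , α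
    arcs (fs (fs (fs (fs fz))))      = vx₀ , vy₀ , β
    pins : Fin 2 → Fin 2 × Fin 4
    pins fz      = x* , vx
    pins (fs fz) = y* , vy

module Submission where

-- The derived graph is bipartite, with x*, x₀ⁱ and yⁱ on one side, so it has no odd cycles. Distinct
-- edges with the same ends would have to be the α- and β-lifts at some x₀ⁱ, which forces α = β. Two
-- vertices with two common neighbours would close a 4-cycle, that is a non-backtracking closed walk of
-- length 4 in G₆ with total voltage 0; running through the possibilities, such a walk forces α = 0,
-- β = 0 or 2α = 2β. So the girth is 6, attained by x* x⁰ y⁰ y* y¹ x¹. For the degrees, translation by a
-- voltage permutes ℤₘ, so every lift vⁱ has the degree of v in G₆, namely 3, while a pinned vertex is
-- joined to all m lifts of its unique neighbour.

open import Defs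
open import Algebra.Bundles using (AbelianGroup)
open import Algebra.Definitions
  using (Commutative; Associative; LeftIdentity; RightIdentity; LeftInverse; LeftCancellative; RightCancellative)
open import Algebra.Structures using (IsAbelianGroup)
open import Algebra.Consequences.Propositional using (comm∧idˡ⇒idʳ; comm∧invˡ⇒inv)
open import Data.Bool using (Bool; true; false; not)
open import Data.Bool.Properties using (not-involutive; not-¬)
open import Data.Nat using (ℕ; zero; suc; _+_; _*_; _∸_; _%_; _≤_; _<_; s≤s; NonZero; >-nonZero⁻¹)
open import Data.Nat.Properties
  using (+-comm; +-assoc; +-identityʳ; *-zeroʳ; *-identityʳ; *-distribˡ-+; m∸n+n≡m; <⇒≤; +-commutativeSemigroup)
open import Data.Nat.DivMod using (_mod_; m%n<n; %-distribˡ-+; m%n%n≡m%n; m<n⇒m%n≡m; [m+n]%n≡m%n)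
open import Data.Nat.ListAction using (sum)
open import Data.Nat.ListAction.Properties using (sum-++)
open import Data.List using (List; []; _∷_; map; _++_; cartesianProduct; allFin)
open import Data.List.Properties using (map-cong; map-∘; map-++; map-tabulate)
open import Data.Fin using (Fin; toℕ) renaming (zero to fz; suc to fs)
open import Data.Fin.Properties using (toℕ-injective; toℕ-fromℕ<; toℕ<n; 0≢1+n; suc-injective)
  renaming (_≟_ to _≟ᶠ_)
open import Data.Product using (_×_; _,_; proj₁; proj₂)
open import Data.Product.Properties using (,-injectiveʳ)
open import Data.Sum using (_⊎_; inj₁; inj₂; swap)
open import Data.Sum.Properties using (inj₂-injective)
open import Data.Empty using (⊥; ⊥-elim)
open import Function using (_∘_; id; _∋_)
open import Function.Definitions using (Injective; StrictlyInverseʳ)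
open import Function.Consequences.Propositional using (inverseʳ⇒injective; strictlyInverseʳ⇒inverseʳ)
open import Relation.Nullary using (Dec; yes; no; ¬_)
open import Relation.Binary.PropositionalEquality
open import Relation.Binary.Definitions using (DecidableEquality)
open ≡-Reasoning
open import Algebra.Properties.CommutativeSemigroup +-commutativeSemigroup using (interchange)

[m%d+n]%d≡[m+n]%d : ∀ a b n .{{_ : NonZero n}} → (a % n + b) % n ≡ (a + b) % n
[m%d+n]%d≡[m+n]%d a b n = begin
  (a % n + b) % n           ≡⟨ %-distribˡ-+ (a % n) b n ⟩
  (a % n % n + b % n) % n   ≡⟨ cong (λ t → (t + b % n) % n) (m%n%n≡m%n a n) ⟩
  (a % n + b % n) % n       ≡⟨ %-distribˡ-+ a b n ⟨
  (a + b) % n               ∎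

[m+n%d]%d≡[m+n]%d : ∀ a b n .{{_ : NonZero n}} → (a + b % n) % n ≡ (a + b) % n
[m+n%d]%d≡[m+n]%d a b n = begin
  (a + b % n) % n ≡⟨ cong (_% n) (+-comm a (b % n)) ⟩
  (b % n + a) % n ≡⟨ [m%d+n]%d≡[m+n]%d b a n ⟩
  (b + a) % n     ≡⟨ cong (_% n) (+-comm b a) ⟩
  (a + b) % n     ∎

toℕ-mod : ∀ a n .{{_ : NonZero n}} → toℕ (a mod n) ≡ a % n
toℕ-mod a n = toℕ-fromℕ< (m%n<n a n)

mod-cong : ∀ a b n .{{_ : NonZero n}} → a % n ≡ b % n → a mod n ≡ b mod n
mod-cong a b n eq = toℕ-injective (trans (toℕ-mod a n) (trans eq (sym (toℕ-mod b n))))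

toℕ-mod≡id : ∀ {n} .{{_ : NonZero n}} (i : Fin n) → toℕ i mod n ≡ i
toℕ-mod≡id {n} i = toℕ-injective (trans (toℕ-mod (toℕ i) n) (m<n⇒m%n≡m (toℕ<n i)))

module Modular (m : ℕ) .{{_ : NonZero m}} where

  infixl 6 _+ₘ_
  infix  8 -ₘ_

  _+ₘ_ : Fin m → Fin m → Fin m
  _+ₘ_ = addMod m

  0ₘ : Fin m
  0ₘ = zeroMod m

  -ₘ_ : Fin m → Fin m
  -ₘ a = (m ∸ toℕ a) mod m

  toℕ-0ₘ : toℕ 0ₘ ≡ 0
  toℕ-0ₘ = trans (toℕ-mod 0 m) (m<n⇒m%n≡m (>-nonZero⁻¹ m))

  +ₘ-comm : Commutative _≡_ _+ₘ_
  +ₘ-comm a b = cong (_mod m) (+-comm (toℕ a) (toℕ b))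

  +ₘ-assoc : Associative _≡_ _+ₘ_
  +ₘ-assoc a b c = mod-cong (toℕ (a +ₘ b) + C) (A + toℕ (b +ₘ c)) m (begin
    (toℕ (a +ₘ b) + C) % m   ≡⟨ cong (λ t → (t + C) % m) (toℕ-mod (A + B) m) ⟩
    ((A + B) % m + C) % m    ≡⟨ [m%d+n]%d≡[m+n]%d (A + B) C m ⟩
    (A + B + C) % m          ≡⟨ cong (_% m) (+-assoc A B C) ⟩
    (A + (B + C)) % m        ≡⟨ [m+n%d]%d≡[m+n]%d A (B + C) m ⟨
    (A + (B + C) % m) % m    ≡⟨ cong (λ t → (A + t) % m) (toℕ-mod (B + C) m) ⟨
    (A + toℕ (b +ₘ c)) % m   ∎)
    where
    A B C : ℕ
    A = toℕ a
    B = toℕ b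
    C = toℕ c

  +ₘ-identityˡ : LeftIdentity _≡_ 0ₘ _+ₘ_
  +ₘ-identityˡ a = trans (cong (λ t → (t + toℕ a) mod m) toℕ-0ₘ) (toℕ-mod≡id a)

  +ₘ-identityʳ : RightIdentity _≡_ 0ₘ _+ₘ_
  +ₘ-identityʳ = comm∧idˡ⇒idʳ +ₘ-comm +ₘ-identityˡ

  +ₘ-inverseˡ : LeftInverse _≡_ 0ₘ -ₘ_ _+ₘ_
  +ₘ-inverseˡ a = mod-cong (toℕ (-ₘ a) + A) 0 m (begin
    (toℕ (-ₘ a) + A) % m    ≡⟨ cong (λ t → (t + A) % m) (toℕ-mod (m ∸ A) m) ⟩
    ((m ∸ A) % m + A) % m   ≡⟨ [m%d+n]%d≡[m+n]%d (m ∸ A) A m ⟩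
    (m ∸ A + A) % m         ≡⟨ cong (_% m) (m∸n+n≡m (<⇒≤ (toℕ<n a))) ⟩
    m % m                   ≡⟨ [m+n]%n≡m%n 0 m ⟩
    0 % m                   ∎)
    where
    A : ℕ
    A = toℕ a

  +ₘ-isAbelianGroup : IsAbelianGroup _≡_ _+ₘ_ 0ₘ -ₘ_
  +ₘ-isAbelianGroup = record
    { isGroup = record
      { isMonoid = record
        { isSemigroup = record
          { isMagma = record { isEquivalence = isEquivalence ; ∙-cong = cong₂ _+ₘ_ }
          ; assoc = +ₘ-assoc
          }
        ; identity = +ₘ-identityˡ , +ₘ-identityʳ
        }
      ; inverse = comm∧invˡ⇒inv +ₘ-comm +ₘ-inverseˡ
      ; ⁻¹-cong = cong -ₘ_
      }
    ; comm = +ₘ-comm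
    }

  ℤₘ : AbelianGroup _ _
  ℤₘ = record { isAbelianGroup = +ₘ-isAbelianGroup }

  open AbelianGroup ℤₘ using (commutativeSemigroup)
  open import Algebra.Properties.AbelianGroup ℤₘ
    using (∙-cancelˡ; ∙-cancelʳ; identityʳ-unique; //-rightDividesˡ)
  open import Algebra.Properties.CommutativeSemigroup commutativeSemigroup
    using () renaming (interchange to +ₘ-interchange)

  +ₘ-cancelˡ : LeftCancellative _≡_ _+ₘ_
  +ₘ-cancelˡ = ∙-cancelˡ

  +ₘ-cancelʳ : RightCancellative _≡_ _+ₘ_
  +ₘ-cancelʳ = ∙-cancelʳ

  +ₘ-fixed⇒0 : ∀ i c → i +ₘ c ≡ i → toℕ c ≡ 0
  +ₘ-fixed⇒0 i c eq = trans (cong toℕ (identityʳ-unique i c eq)) toℕ-0ₘ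

  +ₘ-neg-+ₘ : ∀ j c → (j +ₘ -ₘ c) +ₘ c ≡ j
  +ₘ-neg-+ₘ j c = //-rightDividesˡ c j

  2*toℕ-mod : ∀ a → (2 * toℕ a) mod m ≡ a +ₘ a
  2*toℕ-mod a = cong (λ t → (toℕ a + t) mod m) (+-identityʳ (toℕ a))

  crossed-sums⇒equal-doubles : ∀ i k a b → i +ₘ a ≡ k +ₘ b → i +ₘ b ≡ k +ₘ a → a +ₘ a ≡ b +ₘ b
  crossed-sums⇒equal-doubles i k a b eq₁ eq₂ = +ₘ-cancelˡ (i +ₘ k) (a +ₘ a) (b +ₘ b) (begin
    (i +ₘ k) +ₘ (a +ₘ a) ≡⟨ +ₘ-interchange i k a a ⟩
    (i +ₘ a) +ₘ (k +ₘ a) ≡⟨ cong₂ _+ₘ_ eq₁ (sym eq₂) ⟩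
    (k +ₘ b) +ₘ (i +ₘ b) ≡⟨ +ₘ-interchange k b i b ⟩
    (k +ₘ i) +ₘ (b +ₘ b) ≡⟨ cong (_+ₘ (b +ₘ b)) (+ₘ-comm k i) ⟩
    (i +ₘ k) +ₘ (b +ₘ b) ∎)

indicator : ∀ {A : Set} → Dec A → ℕ
indicator (yes _) = 1
indicator (no _)  = 0

indicator-yes : ∀ {A : Set} (d : Dec A) → A → indicator d ≡ 1
indicator-yes (yes _) _ = refl
indicator-yes (no ¬a) a = ⊥-elim (¬a a)

indicator-no : ∀ {A : Set} (d : Dec A) → ¬ A → indicator d ≡ 0
indicator-no (yes a) ¬a = ⊥-elim (¬a a)
indicator-no (no _)  _  = refl

∑-syntax : ∀ {A : Set} → List A → (A → ℕ) → ℕ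
∑-syntax xs f = sum (map f xs)

syntax ∑-syntax xs (λ x → e) = ∑[ x ∈ xs ] e

module _ {A : Set} where

  ∑-cong : ∀ {f g : A → ℕ} xs → (∀ x → f x ≡ g x) → ∑[ x ∈ xs ] f x ≡ ∑[ x ∈ xs ] g x
  ∑-cong xs f≗g = cong sum (map-cong f≗g xs)

  ∑-zero : ∀ (f : A → ℕ) xs → (∀ x → f x ≡ 0) → ∑[ x ∈ xs ] f x ≡ 0
  ∑-zero f []       f≗0 = refl
  ∑-zero f (x ∷ xs) f≗0 = cong₂ _+_ (f≗0 x) (∑-zero f xs f≗0)

  ∑-++ : ∀ (f : A → ℕ) xs ys → ∑[ x ∈ xs ++ ys ] f x ≡ ∑[ x ∈ xs ] f x + ∑[ y ∈ ys ] f y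
  ∑-++ f xs ys = trans (cong sum (map-++ f xs ys)) (sum-++ (map f xs) (map f ys))

  ∑-+ : ∀ (f g : A → ℕ) xs → ∑[ x ∈ xs ] (f x + g x) ≡ ∑[ x ∈ xs ] f x + ∑[ x ∈ xs ] g x
  ∑-+ f g []       = refl
  ∑-+ f g (x ∷ xs) = trans (cong (f x + g x +_) (∑-+ f g xs)) (interchange (f x) (g x) _ _)

  ∑-*ˡ : ∀ c (f : A → ℕ) xs → ∑[ x ∈ xs ] (c * f x) ≡ c * ∑[ x ∈ xs ] f x
  ∑-*ˡ c f []       = sym (*-zeroʳ c)
  ∑-*ˡ c f (x ∷ xs) = trans (cong (c * f x +_) (∑-*ˡ c f xs)) (sym (*-distribˡ-+ c (f x) _))

  ∑-map : ∀ {B : Set} (f : B → ℕ) (g : A → B) xs → ∑[ y ∈ map g xs ] f y ≡ ∑[ x ∈ xs ] f (g x)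
  ∑-map f g xs = cong sum (sym (map-∘ xs))

∑-cartesianProduct : ∀ {A B : Set} (f : A × B → ℕ) xs ys →
  ∑[ p ∈ cartesianProduct xs ys ] f p ≡ ∑[ x ∈ xs ] ∑[ y ∈ ys ] f (x , y)
∑-cartesianProduct f []       ys = refl
∑-cartesianProduct f (x ∷ xs) ys = begin
  ∑[ p ∈ map (x ,_) ys ++ cartesianProduct xs ys ] f p
    ≡⟨ ∑-++ f (map (x ,_) ys) _ ⟩
  ∑[ p ∈ map (x ,_) ys ] f p + ∑[ p ∈ cartesianProduct xs ys ] f p
    ≡⟨ cong₂ _+_ (∑-map f (x ,_) ys) (∑-cartesianProduct f xs ys) ⟩
  ∑[ y ∈ ys ] f (x , y) + ∑[ x′ ∈ xs ] ∑[ y ∈ ys ] f (x′ , y)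
    ∎

∑-allFin-suc : ∀ {n} (f : Fin (suc n) → ℕ) → ∑[ i ∈ allFin (suc n) ] f i ≡ f fz + ∑[ i ∈ allFin n ] f (fs i)
∑-allFin-suc {n} f = cong (λ xs → f fz + sum xs)
  (trans (map-tabulate fs f) (sym (map-tabulate id (f ∘ fs))))

∑-allFin-const : ∀ n c → ∑[ i ∈ allFin n ] c ≡ n * c
∑-allFin-const zero    c = refl
∑-allFin-const (suc n) c = trans (∑-allFin-suc {n = n} (λ _ → c)) (cong (c +_) (∑-allFin-const n c))

∑-allFin-single : ∀ {n} (f : Fin n → ℕ) i₀ → f i₀ ≡ 1 → (∀ i → i ≢ i₀ → f i ≡ 0) →
  ∑[ i ∈ allFin n ] f i ≡ 1
∑-allFin-single {suc n} f fz      f1 f0 = trans (∑-allFin-suc f)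
  (cong₂ _+_ f1 (∑-zero (f ∘ fs) (allFin n) (λ i → f0 (fs i) (λ ()))))
∑-allFin-single {suc n} f (fs i₀) f1 f0 = trans (∑-allFin-suc f)
  (cong₂ _+_ (f0 fz (λ ())) (∑-allFin-single (f ∘ fs) i₀ f1 (λ i i≢i₀ → f0 (fs i) (i≢i₀ ∘ suc-injective))))

alternating-even : (c : ℕ → Bool) → (∀ t → c (suc t) ≡ not (c t)) → ∀ t → c (t * 2) ≡ c 0
alternating-even c step zero    = refl
alternating-even c step (suc t) = begin
  c (suc (suc (t * 2)))     ≡⟨ step (suc (t * 2)) ⟩
  not (c (suc (t * 2)))     ≡⟨ cong not (step (t * 2)) ⟩
  not (not (c (t * 2)))     ≡⟨ not-involutive (c (t * 2)) ⟩
  c (t * 2)                 ≡⟨ alternating-even c step t ⟩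
  c 0                       ∎

module _ (G : Multigraph) where
  open Multigraph G

  Joins-sym : ∀ {e u v} → Joins G e u v → Joins G e v u
  Joins-sym = swap

  Bipartition : (V → Bool) → Set
  Bipartition side = ∀ {e u v} → Joins G e u v → side v ≡ not (side u)

  Simple : Set
  Simple = ∀ {e e′ u v} → Joins G e u v → Joins G e′ u v → e ≡ e′

  AtMostOneCommonNeighbour : Set
  AtMostOneCommonNeighbour = ∀ {a b p q e₁ e₂ e₃ e₄} → a ≢ b → p ≢ q →
    Joins G e₁ a p → Joins G e₂ a q → Joins G e₃ b p → Joins G e₄ b q → ⊥

  next-mod : ∀ {j} t → next G (t mod suc j) ≡ suc t mod suc j
  next-mod {j} t = mod-cong (1 + toℕ (t mod suc j)) (suc t) (suc j) (begin
    (1 + toℕ (t mod suc j)) % suc j ≡⟨ cong (λ r → (1 + r) % suc j) (toℕ-mod t (suc j)) ⟩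
    (1 + t % suc j) % suc j         ≡⟨ [m+n%d]%d≡[m+n]%d 1 t (suc j) ⟩
    suc t % suc j                   ∎)

  bipartite⇒no-odd-cycle : ∀ {side} → Bipartition side → ∀ k → ¬ CycleOfLength G (suc (k * 2))
  bipartite⇒no-odd-cycle {side} bip k (vs , _ , _ , _ , joins) =
    not-¬ wrap (trans (step (k * 2)) (cong not (alternating-even c step k)))
    where
    len : ℕ
    len = suc (k * 2)
    c : ℕ → Bool
    c t = side (vs (t mod len))
    step : ∀ t → c (suc t) ≡ not (c t)
    step t = trans (cong (side ∘ vs) (sym (next-mod t))) (bip (joins (t mod len)))
    wrap : c len ≡ c 0
    wrap = cong (side ∘ vs) (mod-cong len 0 len ([m+n]%n≡m%n 0 len))

  simple⇒no-2-cycle : Simple → ¬ CycleOfLength G 2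
  simple⇒no-2-cycle simple (_ , _ , _ , es-inj , joins) =
    0≢1+n (es-inj (simple (joins fz) (Joins-sym (joins (fs fz)))))

  atMostOneCommonNeighbour⇒no-4-cycle : AtMostOneCommonNeighbour → ¬ CycleOfLength G 4
  atMostOneCommonNeighbour⇒no-4-cycle c4 (_ , _ , vs-inj , _ , joins) =
    c4 (λ eq → 0≢1+n (vs-inj eq)) (λ eq → 0≢1+n (suc-injective (vs-inj eq)))
       (joins fz) (Joins-sym (joins (fs (fs (fs fz))))) (Joins-sym (joins (fs fz))) (joins (fs (fs fz)))

  incidence : V → E → ℕ
  incidence v e = indicator (proj₁ (ends e) ≟V v) + indicator (proj₂ (ends e) ≟V v)

  mutual
    deg≡∑incidence : ∀ v → deg G v ≡ ∑[ e ∈ edges ] incidence v e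
    deg≡∑incidence v = cong sum (map-cong (incidence-agrees v) edges)

    -- The `_` is the per-edge count inside deg, a where-bound function of Defs that cannot be named here.
    incidence-agrees : ∀ v e → _ ≡ incidence v e
    incidence-agrees v e with proj₁ (ends e) ≟V v | proj₂ (ends e) ≟V v
    ... | yes _ | yes _ = refl
    ... | yes _ | no _  = refl
    ... | no _  | yes _ = refl
    ... | no _  | no _  = refl

δ : ∀ {n} → Fin n → Fin n → ℕ
δ u v = indicator (u ≟ᶠ v)

module DerivedDegree {m : ℕ} .{{_ : NonZero m}} (Γ : VoltageGraph m) where
  open VoltageGraph Γ
  open Modular m

  private
    D : Multigraph
    D = derived Γ

    _≟D_ : DecidableEquality (DVertex Γ)
    _≟D_ = Multigraph._≟V_ D

  arcTail arcHead : Fin nA → Fin nV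
  arcTail k = proj₁ (arc k)
  arcHead k = proj₁ (proj₂ (arc k))

  voltage : Fin nA → Fin m
  voltage k = proj₂ (proj₂ (arc k))

  baseDegree : Fin nV → ℕ
  baseDegree v = ∑[ k ∈ allFin nA ] (δ (arcTail k) v + δ (arcHead k) v)
               + ∑[ k ∈ allFin nE ] δ (proj₂ (pinned k)) v

  pinnedDegree : Fin nP → ℕ
  pinnedDegree p = ∑[ k ∈ allFin nE ] δ (proj₁ (pinned k)) p

  ∑-edges : ∀ (f : DEdge Γ → ℕ) → ∑[ e ∈ Multigraph.edges D ] f e ≡
    ∑[ k ∈ allFin nA ] ∑[ i ∈ allFin m ] f (inj₁ (k , i))
      + ∑[ k ∈ allFin nE ] ∑[ i ∈ allFin m ] f (inj₂ (k , i))
  ∑-edges f = trans (∑-++ f (map inj₁ arcLifts) (map inj₂ pinLifts)) (cong₂ _+_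
    (trans (∑-map f inj₁ arcLifts) (∑-cartesianProduct (f ∘ inj₁) (allFin nA) (allFin m)))
    (trans (∑-map f inj₂ pinLifts) (∑-cartesianProduct (f ∘ inj₂) (allFin nE) (allFin m))))
    where
    arcLifts : List (Fin nA × Fin m)
    arcLifts = cartesianProduct (allFin nA) (allFin m)
    pinLifts : List (Fin nE × Fin m)
    pinLifts = cartesianProduct (allFin nE) (allFin m)

  ∑-lift-indicator : (f g : Fin m → Fin m) → (∀ j → f (g j) ≡ j) → Injective _≡_ _≡_ f →
    ∀ t u j → ∑[ i ∈ allFin m ] indicator (inj₂ (t , f i) ≟D inj₂ (u , j)) ≡ δ t u
  ∑-lift-indicator f g fg f-inj t u j with t ≟ᶠ u
  ... | yes refl = ∑-allFin-single _ (g j) (indicator-yes _ (cong (λ i → inj₂ (t , i)) (fg j)))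
    (λ i i≢gj → indicator-no _ (λ eq → i≢gj (f-inj (trans (,-injectiveʳ (inj₂-injective eq)) (sym (fg j))))))
  -- _≟D_ compares first components with the same t ≟ᶠ u, so each summand has already reduced to 0.
  ... | no _ = ∑-zero _ (allFin m) (λ _ → refl)

  ∑-lift-indicator-id : ∀ t u j → ∑[ i ∈ allFin m ] indicator (inj₂ (t , i) ≟D inj₂ (u , j)) ≡ δ t u
  ∑-lift-indicator-id = ∑-lift-indicator id id (λ _ → refl) id

  ∑-lift-indicator-+ₘ : ∀ a t u j → ∑[ i ∈ allFin m ] indicator (inj₂ (t , i +ₘ a) ≟D inj₂ (u , j)) ≡ δ t u
  ∑-lift-indicator-+ₘ a = ∑-lift-indicator (_+ₘ a) (_+ₘ -ₘ a) (λ j → +ₘ-neg-+ₘ j a) (+ₘ-cancelʳ a _ _)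

  deg-lift : ∀ u j → deg D (inj₂ (u , j)) ≡ baseDegree u
  deg-lift u j = begin
    deg D w                                                        ≡⟨ deg≡∑incidence D w ⟩
    ∑[ e ∈ Multigraph.edges D ] incidence D w e                    ≡⟨ ∑-edges (incidence D w) ⟩
    ∑[ k ∈ allFin nA ] ∑[ i ∈ allFin m ] incidence D w (inj₁ (k , i))
      + ∑[ k ∈ allFin nE ] ∑[ i ∈ allFin m ] incidence D w (inj₂ (k , i))
      ≡⟨ cong₂ _+_ (∑-cong (allFin nA) arc-count) (∑-cong (allFin nE) pin-count) ⟩
    baseDegree u                                                   ∎
    where
    w : DVertex Γ
    w = inj₂ (u , j)
    arc-count : ∀ k → ∑[ i ∈ allFin m ] incidence D w (inj₁ (k , i)) ≡ δ (arcTail k) u + δ (arcHead k) u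
    arc-count k = trans (∑-+ _ _ (allFin m))
      (cong₂ _+_ (∑-lift-indicator-id (arcTail k) u j) (∑-lift-indicator-+ₘ (voltage k) (arcHead k) u j))
    pin-count : ∀ k → ∑[ i ∈ allFin m ] incidence D w (inj₂ (k , i)) ≡ δ (proj₂ (pinned k)) u
    pin-count k = ∑-lift-indicator-id (proj₂ (pinned k)) u j

  indicator-pinned : ∀ p q → indicator (inj₁ p ≟D inj₁ q) ≡ δ p q
  indicator-pinned p q with p ≟ᶠ q
  ... | yes _ = refl
  ... | no _  = refl

  deg-pinned : ∀ q → deg D (inj₁ q) ≡ m * pinnedDegree q
  deg-pinned q = begin
    deg D w                                                        ≡⟨ deg≡∑incidence D w ⟩
    ∑[ e ∈ Multigraph.edges D ] incidence D w e                    ≡⟨ ∑-edges (incidence D w) ⟩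
    ∑[ k ∈ allFin nA ] ∑[ i ∈ allFin m ] incidence D w (inj₁ (k , i))
      + ∑[ k ∈ allFin nE ] ∑[ i ∈ allFin m ] incidence D w (inj₂ (k , i))
      ≡⟨ cong₂ _+_ (∑-zero _ (allFin nA) (λ _ → ∑-zero _ (allFin m) (λ _ → refl)))
                   (∑-cong (allFin nE) pin-count) ⟩
    ∑[ k ∈ allFin nE ] (m * δ (proj₁ (pinned k)) q)                ≡⟨ ∑-*ˡ m _ (allFin nE) ⟩
    m * pinnedDegree q                                             ∎
    where
    w : DVertex Γ
    w = inj₁ q
    pin-count : ∀ k → ∑[ i ∈ allFin m ] incidence D w (inj₂ (k , i)) ≡ m * δ (proj₁ (pinned k)) q
    pin-count k = trans
      (∑-cong (allFin m) (λ i → trans (+-identityʳ _) (indicator-pinned (proj₁ (pinned k)) q)))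
      (∑-allFin-const m _)

module G₆-Derived (m : ℕ) .{{_ : NonZero m}} (α β : Fin m) where
  open Modular m

  D : Multigraph
  D = derived (G₆ m α β)

  Vertex Edge : Set
  Vertex = DVertex (G₆ m α β)
  Edge   = DEdge (G₆ m α β)

  side : Vertex → Bool
  side (inj₁ fz)                   = true
  side (inj₁ (fs _))               = false
  side (inj₂ (fz , _))             = false
  side (inj₂ (fs fz , _))          = true
  side (inj₂ (fs (fs fz) , _))     = false
  side (inj₂ (fs (fs (fs _)) , _)) = true

  -- Link e u v: the edge e joins u ∈ {x*, x₀ⁱ, yⁱ} to v ∈ {xⁱ, y₀ʲ, y*}. The α- and β-arcs carry the
  -- equation j ≡ i + α instead of the index i + α, so that pattern matching can unify indices.
  data Link : Edge → Vertex → Vertex → Set where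
    x*x   : ∀ {i} → Link (inj₂ (fz , i)) (inj₁ x*) (inj₂ (vx , i))
    x₀x   : ∀ {i} → Link (inj₁ (fz , i)) (inj₂ (vx₀ , i)) (inj₂ (vx , i))
    yx    : ∀ {i} → Link (inj₁ (fs fz , i)) (inj₂ (vy , i)) (inj₂ (vx , i))
    yy₀   : ∀ {i} → Link (inj₁ (fs (fs fz) , i)) (inj₂ (vy , i)) (inj₂ (vy₀ , i))
    x₀y₀α : ∀ {i j} → j ≡ i +ₘ α → Link (inj₁ (fs (fs (fs fz)) , i)) (inj₂ (vx₀ , i)) (inj₂ (vy₀ , j))
    x₀y₀β : ∀ {i j} → j ≡ i +ₘ β → Link (inj₁ (fs (fs (fs (fs fz))) , i)) (inj₂ (vx₀ , i)) (inj₂ (vy₀ , j))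
    yy*   : ∀ {i} → Link (inj₂ (fs fz , i)) (inj₂ (vy , i)) (inj₁ y*)

  link-sides : ∀ {e u v} → Link e u v → side u ≡ true × side v ≡ false
  link-sides x*x       = refl , refl
  link-sides x₀x       = refl , refl
  link-sides yx        = refl , refl
  link-sides yy₀       = refl , refl
  link-sides (x₀y₀α _) = refl , refl
  link-sides (x₀y₀β _) = refl , refl
  link-sides yy*       = refl , refl

  ends⇒link : ∀ e {u v} → dEnds (G₆ m α β) e ≡ (u , v) → Link e u v ⊎ Link e v u
  ends⇒link (inj₁ (fz , i)) refl =
    inj₂ (subst (λ k → Link (inj₁ (fz , i)) (inj₂ (vx₀ , k)) (inj₂ (vx , i))) (sym (+ₘ-identityʳ i)) x₀x)
  ends⇒link (inj₁ (fs fz , i)) refl =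
    inj₂ (subst (λ k → Link (inj₁ (fs fz , i)) (inj₂ (vy , k)) (inj₂ (vx , i))) (sym (+ₘ-identityʳ i)) yx)
  ends⇒link (inj₁ (fs (fs fz) , i)) refl =
    inj₁ (subst (λ k → Link (inj₁ (fs (fs fz) , i)) (inj₂ (vy , i)) (inj₂ (vy₀ , k))) (sym (+ₘ-identityʳ i)) yy₀)
  ends⇒link (inj₁ (fs (fs (fs fz)) , i))        refl = inj₁ (x₀y₀α refl)
  ends⇒link (inj₁ (fs (fs (fs (fs fz))) , i))   refl = inj₁ (x₀y₀β refl)
  ends⇒link (inj₂ (fz , i))                     refl = inj₁ x*x
  ends⇒link (inj₂ (fs fz , i))                  refl = inj₂ yy*

  joins⇒link : ∀ {e u v} → Joins D e u v → Link e u v ⊎ Link e v u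
  joins⇒link {e} (inj₁ eq) = ends⇒link e eq
  joins⇒link {e} (inj₂ eq) = swap (ends⇒link e eq)

  bipartite : Bipartition D side
  bipartite j with joins⇒link j
  ... | inj₁ l = let (su , sv) = link-sides l in trans sv (cong not (sym su))
  ... | inj₂ l = let (sv , su) = link-sides l in trans sv (cong not (sym su))

  outgoing : ∀ {e e′ u v w} → Link e u v → Joins D e′ u w → Link e′ u w
  outgoing l j with joins⇒link j
  ... | inj₁ l′ = l′
  ... | inj₂ l′ with () ← trans (sym (proj₁ (link-sides l))) (proj₂ (link-sides l′))

  incoming : ∀ {e e′ u v w} → Link e u v → Joins D e′ w v → Link e′ w v
  incoming l j with joins⇒link j
  ... | inj₁ l′ = l′
  ... | inj₂ l′ with () ← trans (sym (proj₁ (link-sides l′))) (proj₂ (link-sides l))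

  link-unique : α ≢ β → ∀ {e e′ u v} → Link e u v → Link e′ u v → e ≡ e′
  link-unique α≢β x*x        x*x        = refl
  link-unique α≢β x₀x        x₀x        = refl
  link-unique α≢β yx         yx         = refl
  link-unique α≢β yy₀        yy₀        = refl
  link-unique α≢β (x₀y₀α _)  (x₀y₀α _)  = refl
  link-unique α≢β (x₀y₀α h)  (x₀y₀β h′) = ⊥-elim (α≢β (+ₘ-cancelˡ _ α β (trans (sym h) h′)))
  link-unique α≢β (x₀y₀β h)  (x₀y₀α h′) = ⊥-elim (α≢β (+ₘ-cancelˡ _ α β (trans (sym h′) h)))
  link-unique α≢β (x₀y₀β _)  (x₀y₀β _)  = refl
  link-unique α≢β yy*        yy*        = refl

  simple : α ≢ β → Simple D
  simple α≢β j j′ with joins⇒link j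
  ... | inj₁ l = link-unique α≢β l (outgoing l j′)
  ... | inj₂ l = link-unique α≢β l (outgoing l (Joins-sym D j′))

  module _ (α≠0 : toℕ α ≢ 0) (β≠0 : toℕ β ≢ 0) (2α≢2β : α +ₘ α ≢ β +ₘ β) where

    α-fixes : ∀ {i} → i ≡ i +ₘ α → ⊥
    α-fixes {i} h = α≠0 (+ₘ-fixed⇒0 i α (sym h))

    β-fixes : ∀ {i} → i ≡ i +ₘ β → ⊥
    β-fixes {i} h = β≠0 (+ₘ-fixed⇒0 i β (sym h))

    same-x₀ : ∀ c {i k j} → j ≡ i +ₘ c → j ≡ k +ₘ c → (Vertex ∋ inj₂ (vx₀ , i)) ≡ inj₂ (vx₀ , k)
    same-x₀ c {i} {k} h h′ = cong (λ t → inj₂ (vx₀ , t)) (+ₘ-cancelʳ c i k (trans (sym h) h′))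

    same-y₀ : ∀ {j j′ t} → j ≡ t → j′ ≡ t → (Vertex ∋ inj₂ (vy₀ , j)) ≡ inj₂ (vy₀ , j′)
    same-y₀ h h′ = cong (λ t → inj₂ (vy₀ , t)) (trans h (sym h′))

    no-link-square : ∀ {a b p q e₁ e₂ e₃ e₄} → a ≢ b → p ≢ q →
      Link e₁ a p → Link e₂ a q → Link e₃ b p → Link e₄ b q → ⊥
    no-link-square a≢b p≢q x*x x*x x*x x*x = a≢b refl
    no-link-square a≢b p≢q x*x x*x x₀x x₀x = p≢q refl
    no-link-square a≢b p≢q x*x x*x yx yx = p≢q refl
    no-link-square a≢b p≢q x₀x x₀x x*x x*x = p≢q refl
    no-link-square a≢b p≢q x₀x x₀x x₀x x₀x = a≢b refl
    no-link-square a≢b p≢q x₀x x₀x yx yx = p≢q refl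
    no-link-square a≢b p≢q x₀x (x₀y₀α _) x₀x (x₀y₀α _) = a≢b refl
    no-link-square a≢b p≢q x₀x (x₀y₀α _) x₀x (x₀y₀β _) = a≢b refl
    no-link-square a≢b p≢q x₀x (x₀y₀α h₂) yx yy₀ = α-fixes h₂
    no-link-square a≢b p≢q x₀x (x₀y₀β _) x₀x (x₀y₀α _) = a≢b refl
    no-link-square a≢b p≢q x₀x (x₀y₀β _) x₀x (x₀y₀β _) = a≢b refl
    no-link-square a≢b p≢q x₀x (x₀y₀β h₂) yx yy₀ = β-fixes h₂
    no-link-square a≢b p≢q yx yx x*x x*x = p≢q refl
    no-link-square a≢b p≢q yx yx x₀x x₀x = p≢q refl
    no-link-square a≢b p≢q yx yx yx yx = a≢b refl
    no-link-square a≢b p≢q yx yy₀ x₀x (x₀y₀α h₄) = α-fixes h₄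
    no-link-square a≢b p≢q yx yy₀ x₀x (x₀y₀β h₄) = β-fixes h₄
    no-link-square a≢b p≢q yx yy₀ yx yy₀ = a≢b refl
    no-link-square a≢b p≢q yx yy* yx yy* = a≢b refl
    no-link-square a≢b p≢q yy₀ yx yy₀ yx = a≢b refl
    no-link-square a≢b p≢q yy₀ yx (x₀y₀α h₃) x₀x = α-fixes h₃
    no-link-square a≢b p≢q yy₀ yx (x₀y₀β h₃) x₀x = β-fixes h₃
    no-link-square a≢b p≢q yy₀ yy₀ yy₀ yy₀ = a≢b refl
    no-link-square a≢b p≢q yy₀ yy₀ (x₀y₀α _) (x₀y₀α _) = p≢q refl
    no-link-square a≢b p≢q yy₀ yy₀ (x₀y₀α _) (x₀y₀β _) = p≢q refl
    no-link-square a≢b p≢q yy₀ yy₀ (x₀y₀β _) (x₀y₀α _) = p≢q refl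
    no-link-square a≢b p≢q yy₀ yy₀ (x₀y₀β _) (x₀y₀β _) = p≢q refl
    no-link-square a≢b p≢q yy₀ yy* yy₀ yy* = a≢b refl
    no-link-square a≢b p≢q (x₀y₀α h₁) x₀x yy₀ yx = α-fixes h₁
    no-link-square a≢b p≢q (x₀y₀α _) x₀x (x₀y₀α _) x₀x = a≢b refl
    no-link-square a≢b p≢q (x₀y₀α _) x₀x (x₀y₀β _) x₀x = a≢b refl
    no-link-square a≢b p≢q (x₀y₀α _) (x₀y₀α _) yy₀ yy₀ = p≢q refl
    no-link-square a≢b p≢q (x₀y₀α h₁) (x₀y₀α _) (x₀y₀α h₃) (x₀y₀α _) = a≢b (same-x₀ α h₁ h₃)
    no-link-square a≢b p≢q (x₀y₀α h₁) (x₀y₀α _) (x₀y₀α h₃) (x₀y₀β _) = a≢b (same-x₀ α h₁ h₃)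
    no-link-square a≢b p≢q (x₀y₀α _) (x₀y₀α h₂) (x₀y₀β _) (x₀y₀α h₄) = a≢b (same-x₀ α h₂ h₄)
    no-link-square a≢b p≢q (x₀y₀α h₁) (x₀y₀α h₂) (x₀y₀β _) (x₀y₀β _) = p≢q (same-y₀ h₁ h₂)
    no-link-square a≢b p≢q (x₀y₀α _) (x₀y₀β _) yy₀ yy₀ = p≢q refl
    no-link-square a≢b p≢q (x₀y₀α h₁) (x₀y₀β _) (x₀y₀α h₃) (x₀y₀α _) = a≢b (same-x₀ α h₁ h₃)
    no-link-square a≢b p≢q (x₀y₀α h₁) (x₀y₀β _) (x₀y₀α h₃) (x₀y₀β _) = a≢b (same-x₀ α h₁ h₃)
    no-link-square a≢b p≢q (x₀y₀α {i₁} h₁) (x₀y₀β h₂) (x₀y₀β {i₃} h₃) (x₀y₀α h₄) =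
      2α≢2β (crossed-sums⇒equal-doubles i₁ i₃ α β (trans (sym h₁) h₃) (trans (sym h₂) h₄))
    no-link-square a≢b p≢q (x₀y₀α _) (x₀y₀β h₂) (x₀y₀β _) (x₀y₀β h₄) = a≢b (same-x₀ β h₂ h₄)
    no-link-square a≢b p≢q (x₀y₀β h₁) x₀x yy₀ yx = β-fixes h₁
    no-link-square a≢b p≢q (x₀y₀β _) x₀x (x₀y₀α _) x₀x = a≢b refl
    no-link-square a≢b p≢q (x₀y₀β _) x₀x (x₀y₀β _) x₀x = a≢b refl
    no-link-square a≢b p≢q (x₀y₀β _) (x₀y₀α _) yy₀ yy₀ = p≢q refl
    no-link-square a≢b p≢q (x₀y₀β _) (x₀y₀α h₂) (x₀y₀α _) (x₀y₀α h₄) = a≢b (same-x₀ α h₂ h₄)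
    no-link-square a≢b p≢q (x₀y₀β {i₁} h₁) (x₀y₀α h₂) (x₀y₀α {i₃} h₃) (x₀y₀β h₄) =
      2α≢2β (crossed-sums⇒equal-doubles i₁ i₃ α β (trans (sym h₂) h₄) (trans (sym h₁) h₃))
    no-link-square a≢b p≢q (x₀y₀β h₁) (x₀y₀α _) (x₀y₀β h₃) (x₀y₀α _) = a≢b (same-x₀ β h₁ h₃)
    no-link-square a≢b p≢q (x₀y₀β h₁) (x₀y₀α _) (x₀y₀β h₃) (x₀y₀β _) = a≢b (same-x₀ β h₁ h₃)
    no-link-square a≢b p≢q (x₀y₀β _) (x₀y₀β _) yy₀ yy₀ = p≢q refl
    no-link-square a≢b p≢q (x₀y₀β h₁) (x₀y₀β h₂) (x₀y₀α _) (x₀y₀α _) = p≢q (same-y₀ h₁ h₂)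
    no-link-square a≢b p≢q (x₀y₀β _) (x₀y₀β h₂) (x₀y₀α _) (x₀y₀β h₄) = a≢b (same-x₀ β h₂ h₄)
    no-link-square a≢b p≢q (x₀y₀β h₁) (x₀y₀β _) (x₀y₀β h₃) (x₀y₀α _) = a≢b (same-x₀ β h₁ h₃)
    no-link-square a≢b p≢q (x₀y₀β h₁) (x₀y₀β _) (x₀y₀β h₃) (x₀y₀β _) = a≢b (same-x₀ β h₁ h₃)
    no-link-square a≢b p≢q yy* yx yy* yx = a≢b refl
    no-link-square a≢b p≢q yy* yy₀ yy* yy₀ = a≢b refl
    no-link-square a≢b p≢q yy* yy* yy* yy* = p≢q refl

    atMostOneCommonNeighbour : AtMostOneCommonNeighbour D
    atMostOneCommonNeighbour a≢b p≢q j₁ j₂ j₃ j₄ with joins⇒link j₁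
    ... | inj₁ l₁ = let l₃ = incoming l₁ j₃ in
      no-link-square a≢b p≢q l₁ (outgoing l₁ j₂) l₃ (outgoing l₃ j₄)
    ... | inj₂ l₁ = let l₃ = outgoing l₁ (Joins-sym D j₃) in
      no-link-square p≢q a≢b l₁ l₃ (incoming l₁ (Joins-sym D j₂)) (incoming l₃ (Joins-sym D j₄))

  open DerivedDegree (G₆ m α β) using (baseDegree; deg-lift; deg-pinned)

  baseDegree≡3 : ∀ v → baseDegree v ≡ 3
  baseDegree≡3 fz                = refl
  baseDegree≡3 (fs fz)           = refl
  baseDegree≡3 (fs (fs fz))      = refl
  baseDegree≡3 (fs (fs (fs fz))) = refl

  deg-lifted : ∀ v i → deg D (inj₂ (v , i)) ≡ 3
  deg-lifted v i = trans (deg-lift v i) (baseDegree≡3 v)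

  deg-x* : deg D (inj₁ x*) ≡ m
  deg-x* = trans (deg-pinned x*) (*-identityʳ m)

  deg-y* : deg D (inj₁ y*) ≡ m
  deg-y* = trans (deg-pinned y*) (*-identityʳ m)

  no-short-cycle : α ≢ β → toℕ α ≢ 0 → toℕ β ≢ 0 → α +ₘ α ≢ β +ₘ β → ∀ k → k < 6 → ¬ CycleOfLength D k
  no-short-cycle _   _   _   _     0 _ ()
  no-short-cycle _   _   _   _     1 _ = bipartite⇒no-odd-cycle D bipartite 0
  no-short-cycle α≢β _   _   _     2 _ = simple⇒no-2-cycle D (simple α≢β)
  no-short-cycle _   _   _   _     3 _ = bipartite⇒no-odd-cycle D bipartite 1
  no-short-cycle _   α≠0 β≠0 2α≢2β 4 _ =
    atMostOneCommonNeighbour⇒no-4-cycle D (atMostOneCommonNeighbour α≠0 β≠0 2α≢2β)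
  no-short-cycle _   _   _   _     5 _ = bipartite⇒no-odd-cycle D bipartite 2
  no-short-cycle _   _   _   _     (suc (suc (suc (suc (suc (suc _)))))) (s≤s (s≤s (s≤s (s≤s (s≤s (s≤s ()))))))

retraction⇒injective : ∀ {A B : Set} (f : A → B) (g : B → A) → StrictlyInverseʳ _≡_ f g → Injective _≡_ _≡_ f
retraction⇒injective f g g∘f≗id = inverseʳ⇒injective {f⁻¹ = g} f (strictlyInverseʳ⇒inverseʳ f g∘f≗id)

hexagon : ∀ n (α β : Fin (suc (suc n))) → CycleOfLength (derived (G₆ (suc (suc n)) α β)) 6
hexagon n α β = vs , es , retraction⇒injective vs vertex-index vertex-position
                        , retraction⇒injective es edge-index edge-position , joins
  where
  open Modular (suc (suc n))
  open G₆-Derived (suc (suc n)) α β using (D; Vertex; Edge)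

  vs : Fin 6 → Vertex
  vs fz                          = inj₁ x*
  vs (fs fz)                     = inj₂ (vx , fz)
  vs (fs (fs fz))                = inj₂ (vy , fz)
  vs (fs (fs (fs fz)))           = inj₁ y*
  vs (fs (fs (fs (fs fz))))      = inj₂ (vy , fs fz)
  vs (fs (fs (fs (fs (fs fz))))) = inj₂ (vx , fs fz)

  es : Fin 6 → Edge
  es fz                          = inj₂ (fz , fz)
  es (fs fz)                     = inj₁ (fs fz , fz)
  es (fs (fs fz))                = inj₂ (fs fz , fz)
  es (fs (fs (fs fz)))           = inj₂ (fs fz , fs fz)
  es (fs (fs (fs (fs fz))))      = inj₁ (fs fz , fs fz)
  es (fs (fs (fs (fs (fs fz))))) = inj₂ (fz , fs fz)

  vertex-index : Vertex → Fin 6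
  vertex-index (inj₁ fz)                       = fz
  vertex-index (inj₂ (fz , fz))                = fs fz
  vertex-index (inj₂ (fs (fs (fs fz)) , fz))   = fs (fs fz)
  vertex-index (inj₁ (fs _))                   = fs (fs (fs fz))
  vertex-index (inj₂ (fs (fs (fs fz)) , fs _)) = fs (fs (fs (fs fz)))
  vertex-index (inj₂ (fz , fs _))              = fs (fs (fs (fs (fs fz))))
  vertex-index (inj₂ _)                        = fz

  edge-index : Edge → Fin 6
  edge-index (inj₂ (fz , fz))         = fz
  edge-index (inj₁ (fs fz , fz))      = fs fz
  edge-index (inj₂ (fs fz , fz))      = fs (fs fz)
  edge-index (inj₂ (fs fz , fs _))    = fs (fs (fs fz))
  edge-index (inj₁ (fs fz , fs _))    = fs (fs (fs (fs fz)))
  edge-index (inj₂ (fz , fs _))       = fs (fs (fs (fs (fs fz))))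
  edge-index _                        = fz

  vertex-position : StrictlyInverseʳ _≡_ vs vertex-index
  vertex-position fz                          = refl
  vertex-position (fs fz)                     = refl
  vertex-position (fs (fs fz))                = refl
  vertex-position (fs (fs (fs fz)))           = refl
  vertex-position (fs (fs (fs (fs fz))))      = refl
  vertex-position (fs (fs (fs (fs (fs fz))))) = refl

  edge-position : StrictlyInverseʳ _≡_ es edge-index
  edge-position fz                          = refl
  edge-position (fs fz)                     = refl
  edge-position (fs (fs fz))                = refl
  edge-position (fs (fs (fs fz)))           = refl
  edge-position (fs (fs (fs (fs fz))))      = refl
  edge-position (fs (fs (fs (fs (fs fz))))) = refl

  joins : ∀ i → Joins D (es i) (vs i) (vs (next D i))
  joins fz                          = inj₁ refl
  joins (fs fz)                     = inj₁ (cong (λ t → inj₂ (vx , fz) , inj₂ (vy , t)) (+ₘ-identityʳ fz))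
  joins (fs (fs fz))                = inj₂ refl
  joins (fs (fs (fs fz)))           = inj₁ refl
  joins (fs (fs (fs (fs fz))))      =
    inj₂ (cong (λ t → inj₂ (vx , fs fz) , inj₂ (vy , t)) (+ₘ-identityʳ (fs fz)))
  joins (fs (fs (fs (fs (fs fz))))) = inj₂ refl

theorem2 : (m : ℕ) .{{_ : NonZero m}} → 3 ≤ m → (α β : Fin m) →
    toℕ α ≢ 0 → toℕ β ≢ 0 → α ≢ β →
    (2 * toℕ α) mod m ≢ (2 * toℕ β) mod m →
    HasGirth (derived (G₆ m α β)) 6
    × Is3mgGraph (derived (G₆ m α β)) m 6
    × deg (derived (G₆ m α β)) (inj₁ x*) ≡ m
    × deg (derived (G₆ m α β)) (inj₁ y*) ≡ m
    × (∀ v i → deg (derived (G₆ m α β)) (inj₂ (v , i)) ≡ 3)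
theorem2 m@(suc (suc (suc _))) (s≤s (s≤s (s≤s _))) α β α≠0 β≠0 α≢β 2α≢2β =
  girth , (girth , degrees) , deg-x* , deg-y* , deg-lifted
  where
  open Modular m using (2*toℕ-mod)
  open G₆-Derived m α β

  girth : HasGirth D 6
  girth = hexagon _ α β , no-short-cycle α≢β α≠0 β≠0
    (λ eq → 2α≢2β (trans (2*toℕ-mod α) (trans eq (sym (2*toℕ-mod β)))))

  degrees : ∀ v → deg D v ≡ 3 ⊎ deg D v ≡ m
  degrees (inj₁ fz)      = inj₂ deg-x*
  degrees (inj₁ (fs fz)) = inj₂ deg-y*
  degrees (inj₂ (v , i)) = inj₁ (deg-lifted v i)
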